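{- For integers $n\ge 2$ and $1\le k\le n-1$, let $H_k(n) := 1+\sum_{i=1}^{n-1}\frac{(n+i-1-k)!}{i!}\,i^k$. Then for all integers $n\ge 2$, $k\ge 2$ with $n\ge k+1$, \[ H_k(n)\equiv 1+\sum_{i=1}^{k}\frac{(n+i-1-k)!}{i!}\,i^k \pmod n. \] -}

module Defs where

open import Data.Nat using (ℕ; zero; suc; _+_; _*_; _∸_; _^_; _/_; _!)
open import Data.Nat.Properties using (_!≢0)

sum1 : ℕ → (ℕ → ℕ) → ℕ
sum1 zero    f = 0
sum1 (suc m) f = sum1 m f + f (suc m)

-- the summand  (n+i-1-k)! / i! * i^k  (the division is exact whenever n ≥ k+1, i ≥ 1)
term : ℕ → ℕ → ℕ → ℕ
term n k i = ((n + i ∸ 1 ∸ k) ! / (i !)) {{i !≢0}} * i ^ k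

H : ℕ → ℕ → ℕ
H k n = 1 + sum1 (n ∸ 1) (term n k)

module Submission where

-- Let  n = k + 1 + e  (so e = n - 1 - k ≥ 0).  For an index i with k < i ≤ n - 1
-- the summand of H_k(n) is
--     (n + i - 1 - k)! / i! · i^k  =  (i+1)(i+2)⋯(i+e) · i^k ,
-- and the block of consecutive integers i+1, …, i+e contains n itself, because
-- i + 1 ≤ n ≤ i + e.  Hence every summand with index beyond k is divisible by n,
-- and deleting them from H_k(n) does not change its residue modulo n.

open import Defs
open import Data.Nat using (ℕ; zero; suc; _+_; _*_; _∸_; _^_; _/_; _%_; _!; _≤_; _<_; s≤s; z≤n; NonZero)
open import Data.Nat.Properties
open import Data.Nat.Divisibility using (_∣_; ∣-refl; ∣m⇒∣m*n; ∣n⇒∣m*n; ∣m∣n⇒∣m+n; _∣0)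
open import Data.Nat.DivMod using (m*n/n≡m; %-remove-+ʳ)
open import Data.Product using (_,_)
open import Relation.Binary.PropositionalEquality using (_≡_; refl; sym; cong; subst; module ≡-Reasoning)
open import Relation.Nullary using (yes; no)
open import Relation.Nullary.Negation using (contradiction)

rising : ℕ → ℕ → ℕ
rising i zero    = 1
rising i (suc d) = suc (i + d) * rising i d

factorial-rising : ∀ i d → (i + d) ! ≡ rising i d * i !
factorial-rising i zero    = begin
  (i + 0) !      ≡⟨ cong _! (+-identityʳ i) ⟩
  i !            ≡⟨ sym (*-identityˡ (i !)) ⟩
  1 * i !        ∎
  where open ≡-Reasoning
factorial-rising i (suc d) = begin
  (i + suc d) !                    ≡⟨ cong _! (+-suc i d) ⟩
  suc (i + d) * (i + d) !          ≡⟨ cong (suc (i + d) *_) (factorial-rising i d) ⟩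
  suc (i + d) * (rising i d * i !) ≡⟨ sym (*-assoc (suc (i + d)) (rising i d) (i !)) ⟩
  rising i (suc d) * i !           ∎
  where open ≡-Reasoning

factorial-quotient : ∀ i d → ((i + d) ! / i !) {{i !≢0}} ≡ rising i d
factorial-quotient i d rewrite factorial-rising i d = m*n/n≡m (rising i d) (i !) {{i !≢0}}

rising-divisible : ∀ {m} i d → i < m → m ≤ i + d → m ∣ rising i d
rising-divisible {m} i zero    i<m m≤i+0 =
  contradiction (subst (m ≤_) (+-identityʳ i) m≤i+0) (<⇒≱ i<m)
rising-divisible {m} i (suc d) i<m m≤i+1+d with m ≤? i + d
... | yes m≤i+d = ∣n⇒∣m*n (suc (i + d)) (rising-divisible i d i<m m≤i+d)
... | no  m≰i+d = subst (_∣ rising i (suc d)) (sym m≡1+i+d) (∣m⇒∣m*n (rising i d) ∣-refl)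
  where
  m≡1+i+d : m ≡ suc (i + d)
  m≡1+i+d = ≤-antisym (subst (m ≤_) (+-suc i d) m≤i+1+d) (≰⇒> m≰i+d)

summand-factorial : ∀ k e i → suc k + e + i ∸ 1 ∸ k ≡ i + e
summand-factorial k e i = begin
  k + e + i ∸ k      ≡⟨ cong (_∸ k) (+-assoc k e i) ⟩
  k + (e + i) ∸ k    ≡⟨ m+n∸m≡n k (e + i) ⟩
  e + i              ≡⟨ +-comm e i ⟩
  i + e              ∎
  where open ≡-Reasoning

term-divisible : ∀ k e i → k < i → i < suc k + e → suc k + e ∣ term (suc k + e) k i
term-divisible k e i k<i i<n = ∣m⇒∣m*n (i ^ k) n∣quotient
  where
  n = suc k + e
  quotient≡rising : ((n + i ∸ 1 ∸ k) ! / i !) {{i !≢0}} ≡ rising i e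
  quotient≡rising rewrite summand-factorial k e i = factorial-quotient i e
  n∣quotient : n ∣ ((n + i ∸ 1 ∸ k) ! / i !) {{i !≢0}}
  n∣quotient = subst (n ∣_) (sym quotient≡rising)
                 (rising-divisible i e i<n (+-monoˡ-≤ e k<i))

sum1-split : ∀ (f : ℕ → ℕ) k j → sum1 (k + j) f ≡ sum1 k f + sum1 j (λ i → f (k + i))
sum1-split f k zero    rewrite +-identityʳ k = sym (+-identityʳ (sum1 k f))
sum1-split f k (suc j) rewrite +-suc k j | sum1-split f k j =
  +-assoc (sum1 k f) (sum1 j (λ i → f (k + i))) (f (suc (k + j)))

sum1-divisible : ∀ {n} (f : ℕ → ℕ) j → (∀ i → 0 < i → i ≤ j → n ∣ f i) → n ∣ sum1 j f
sum1-divisible f zero    _    = _ ∣0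
sum1-divisible f (suc j) n∣fi = ∣m∣n⇒∣m+n
  (sum1-divisible f j (λ i 0<i i≤j → n∣fi i 0<i (m≤n⇒m≤1+n i≤j)))
  (n∣fi (suc j) (s≤s z≤n) ≤-refl)

drop-divisible-tail : ∀ n .{{_ : NonZero n}} (f : ℕ → ℕ) a k j →
  (∀ i → k < i → i ≤ k + j → n ∣ f i) →
  (a + sum1 (k + j) f) % n ≡ (a + sum1 k f) % n
drop-divisible-tail n f a k j n∣fi = begin
  (a + sum1 (k + j) f) % n                         ≡⟨ cong (λ s → (a + s) % n) (sum1-split f k j) ⟩
  (a + (sum1 k f + sum1 j (λ i → f (k + i)))) % n  ≡⟨ cong (_% n) (sym (+-assoc a _ _)) ⟩
  (a + sum1 k f + sum1 j (λ i → f (k + i))) % n    ≡⟨ %-remove-+ʳ (a + sum1 k f) n∣tail ⟩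
  (a + sum1 k f) % n                               ∎
  where
  open ≡-Reasoning
  n∣tail : n ∣ sum1 j (λ i → f (k + i))
  n∣tail = sum1-divisible (λ i → f (k + i)) j
    (λ i 0<i i≤j → n∣fi (k + i) (subst (_≤ k + i) (+-comm k 1) (+-monoʳ-≤ k 0<i))
                                  (+-monoʳ-≤ k i≤j))

mainTheorem6 : (n k : ℕ) .{{_ : NonZero n}} → 2 ≤ n → 2 ≤ k → k + 1 ≤ n →
    H k n % n ≡ (1 + sum1 k (term n k)) % n
mainTheorem6 n k _ _ k+1≤n with m≤n⇒∃[o]m+o≡n (subst (_≤ n) (+-comm k 1) k+1≤n)
... | e , refl = drop-divisible-tail (suc k + e) (term (suc k + e) k) 1 k e
                   (λ i k<i i≤k+e → term-divisible k e i k<i (s≤s i≤k+e))
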